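{- Let $b\ge2$, $A=\{0,\dots,b-1\}$, let $p_1,p_2$ be primes, let $x\in A^\omega$, fix an integer $k\ge0$ and a family $(\delta_{i_1,i_2})_{0\le i_1,i_2\le k}$ of integers. Then the following are equivalent: (a) for every family $(u_{i_1,i_2})_{0\le i_1,i_2\le k}$ of finite words over $A$, $$\lim_{N\to\infty}\frac1N\#\Big\{n:1\le n\le N,\ \text{for all }0\le i_1,i_2\le k,\ u_{i_1,i_2}\text{ occurs in }x\text{ at position }(p_1-1)(p_2-1)p_1^{i_1}p_2^{i_2}n\Big\}=b^{ -\sum_{i_1,i_2}|u_{i_1,i_2}|};$$ (b) for every family $(v_{i_1,i_2})_{0\le i_1,i_2\le k}$ of finite words over $A$, $$\lim_{N\to\infty}\frac1N\#\Big\{n:1\le n\le N,\ \text{for all }0\le i_1,i_2\le k,\ v_{i_1,i_2}\text{ occurs in }x\text{ at position }(p_1-1)(p_2-1)p_1^{i_1}p_2^{i_2}n+\delta_{i_1,i_2}\Big\}=b^{ -\sum_{i_1,i_2}|v_{i_1,i_2}|}.$$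
   Context: Words are finite sequences over $A$; $|u|$ denotes length. For $x=a_1a_2\cdots$, a word $u$ occurs in $x$ at position $m\ge1$ if $a_m\cdots a_{m+|u|-1}=u$; a word is considered not to occur at a position $m\le 0$ (only finitely many $n$ are affected, which does not influence the limits). -}

module Defs where

open import Data.Nat as ℕ using (ℕ; zero; suc; _^_; _∸_)
open import Data.Nat.Properties using (m^n≢0)
open import Data.Integer as ℤ using (ℤ; +_; -[1+_])
open import Data.Rational as ℚ using (ℚ; 0ℚ; _<_; ∣_∣; _-_)
open import Data.Fin using (Fin; _≟_)
open import Data.Bool using (Bool; true; false; _∧_)
open import Data.List using (List; []; _∷_; length; map; allFin; filter; upTo)
open import Data.Bool.ListAction using (and)
open import Data.Nat.ListAction using (sum)
open import Data.Product using (∃; _×_)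
open import Relation.Nullary.Decidable using (⌊_⌋)

-- An infinite word x = a₁a₂a₃⋯ over A = Fin b is a function ℕ → Fin b,
-- with a_{m} = x (m ∸ 1), i.e. x uses 0-based indexing internally.

occ0 : {b : ℕ} → (ℕ → Fin b) → List (Fin b) → ℕ → Bool
occ0 x []      i = true
occ0 x (c ∷ u) i = ⌊ x i ≟ c ⌋ ∧ occ0 x u (suc i)

occursAt : {b : ℕ} → (ℕ → Fin b) → List (Fin b) → ℤ → Bool
occursAt x u (+ zero)  = false
occursAt x u (+ suc m) = occ0 x u m
occursAt x u -[1+ _ ]  = false

countUpTo : (ℕ → Bool) → ℕ → ℕ
countUpTo P N = length (filter (λ n → P (suc n) Data.Bool.≟ true) (upTo N))

allPairs : (k : ℕ) → (Fin (suc k) → Fin (suc k) → Bool) → Bool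
allPairs k Q = and (map (λ i₁ → and (map (λ i₂ → Q i₁ i₂) (allFin (suc k)))) (allFin (suc k)))

totalLength : {b k : ℕ} → (Fin (suc k) → Fin (suc k) → List (Fin b)) → ℕ
totalLength {k = k} u =
  sum (map (λ i₁ → sum (map (λ i₂ → length (u i₁ i₂)) (allFin (suc k)))) (allFin (suc k)))

-- b ^ (- L) as a rational (the value for b = 0 is irrelevant, b ≥ 2 is assumed)
invPow : ℕ → ℕ → ℚ
invPow zero    L = 0ℚ
invPow (suc c) L = (+ 1) ℚ./ (suc c ^ L)
  where instance _ = m^n≢0 (suc c) L

Tends : (ℕ → ℚ) → ℚ → Set
Tends f L = ∀ (ε : ℚ) → 0ℚ < ε → ∃ λ N₀ → ∀ N → N₀ ℕ.≤ N → ∣ f N - L ∣ < ε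

-- (1/N) #{ n : 1 ≤ n ≤ N, P n }, defined for N ≥ 1; the sequence is indexed so
-- that freq P N is the value at N+1 (shift does not affect the limit)
freq : (ℕ → Bool) → ℕ → ℚ
freq P N = (+ countUpTo P (suc N)) ℚ./ suc N

pos : (p₁ p₂ : ℕ) → ℕ → ℕ → ℕ → ℤ → ℤ
pos p₁ p₂ i₁ i₂ n d = (+ ((p₁ ∸ 1) ℕ.* (p₂ ∸ 1) ℕ.* p₁ ^ i₁ ℕ.* p₂ ^ i₂ ℕ.* n)) ℤ.+ d

open import Data.Fin using (toℕ)

-- condition (a)/(b) with shift family δ (δ = 0 gives (a))
ShiftedNormal : (b : ℕ) (p₁ p₂ : ℕ) (x : ℕ → Fin b) (k : ℕ)
  (δ : Fin (suc k) → Fin (suc k) → ℤ) → Set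
ShiftedNormal b p₁ p₂ x k δ =
  ∀ (u : Fin (suc k) → Fin (suc k) → List (Fin b)) →
    Tends (freq (λ n → allPairs k (λ i₁ i₂ →
             occursAt x (u i₁ i₂) (pos p₁ p₂ (toℕ i₁) (toℕ i₂) n (δ i₁ i₂)))))
          (invPow b (totalLength u))

-- Replacing n by n + t turns the shift δ(i₁,i₂) into δ(i₁,i₂) + c(i₁,i₂)·t, where
-- c(i₁,i₂) = (p₁-1)(p₂-1)p₁^i₁ p₂^i₂ ≥ 1, and moves every frequency by at most t/N; so normality
-- along δ and along δ + c·t are equivalent. Raising a single nonnegative shift by one preserves
-- normality: the n counted for a family v with the raised shift are the disjoint union, over the
-- b letters a, of those counted for v with a prepended at that index and the old shift, and the
-- limits b^-(L+1) add up to b^-L. Hence normality along nonnegative shifts passes to larger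
-- shifts, and with T = Σ|δ| the inequalities 0 ≤ δ + c·T ≤ 0 + c·2T give both implications.
-- Primality of p₁ and p₂ is used only through c ≥ 1.

module Submission where

open import Data.Nat as ℕ using (ℕ; zero; suc; _⊔_)
import Data.Nat.Properties as ℕP
open import Data.Integer as ℤ using (ℤ; +_; -[1+_])
import Data.Integer.Properties as ℤP
import Data.Integer.Solver
open import Data.Rational using (ℚ; 0ℚ; mkℚ; toℚᵘ; _/_; *<*)
import Data.Rational.Properties as ℚP
import Data.Rational.Unnormalised as U
import Data.Rational.Unnormalised.Properties as UP
open import Data.Rational.Solver using (module +-*-Solver)
open import Data.List using (List; []; _∷_; map; foldr; length; filter; upTo; _++_; [_]; allFin)
import Data.List.Properties as LP
open import Data.Nat.ListAction using (sum)
import Data.Nat.Solver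
open import Data.Bool using (Bool; true; false; _∧_; if_then_else_)
import Data.Bool as B
import Data.Bool.Properties as BP
open import Data.Bool.ListAction using (and)
open import Data.List.Membership.Propositional using (_∈_)
open import Data.List.Membership.Propositional.Properties using (∈-allFin)
open import Data.List.Relation.Unary.Any using (here; there)
open import Data.Fin using (Fin; zero; suc; _≟_; toℕ)
open import Relation.Nullary.Decidable using (⌊_⌋; yes; no; dec-true; does-⇔; isYes≗does)
open import Data.Product using (∃; _×_; _,_)
open import Relation.Binary.PropositionalEquality hiding ([_])
open import Data.Nat.Primality using (Prime; prime⇒nonTrivial)
open import Function.Bundles using (_⇔_; mk⇔; Equivalence)
open import Defs

module ℤS = Data.Integer.Solver.+-*-Solver

module _ where
  open import Data.Nat using (_+_; _*_; _≤_; z≤n)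

  χ : Bool → ℕ
  χ true  = 1
  χ false = 0

  χ≤1 : ∀ v → χ v ≤ 1
  χ≤1 true  = ℕP.≤-refl
  χ≤1 false = z≤n

  χ-∧ : ∀ p q → χ (p ∧ q) ≡ χ p * χ q
  χ-∧ true  q = sym (ℕP.+-identityʳ (χ q))
  χ-∧ false q = refl

  count : (ℕ → Bool) → ℕ → ℕ
  count P zero    = 0
  count P (suc N) = count P N + χ (P (suc N))

  countUpTo≡count : ∀ P N → countUpTo P N ≡ count P N
  countUpTo≡count P zero    = refl
  countUpTo≡count P (suc N) = begin
    length (filter D (upTo (suc N)))                      ≡⟨ cong (λ l → length (filter D l)) (sym (LP.upTo-∷ʳ N)) ⟩
    length (filter D (upTo N ++ [ N ]))                    ≡⟨ cong length (LP.filter-++ D (upTo N) [ N ]) ⟩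
    length (filter D (upTo N) ++ filter D [ N ])           ≡⟨ LP.length-++ (filter D (upTo N)) ⟩
    length (filter D (upTo N)) + length (filter D [ N ])   ≡⟨ cong₂ _+_ (countUpTo≡count P N) last ⟩
    count P N + χ (P (suc N))                              ∎
    where
    open ≡-Reasoning
    D = λ n → P (suc n) B.≟ true
    last : length (filter D [ N ]) ≡ χ (P (suc N))
    last with P (suc N)
    ... | true  = refl
    ... | false = refl

  count≤ : ∀ P N → count P N ≤ N
  count≤ P zero    = z≤n
  count≤ P (suc N) = subst (count P N + χ (P (suc N)) ≤_) (ℕP.+-comm N 1)
    (ℕP.+-mono-≤ (count≤ P N) (χ≤1 (P (suc N))))

  count-cong : ∀ {P Q} → (∀ n → P n ≡ Q n) → ∀ N → count P N ≡ count Q N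
  count-cong P≡Q zero    = refl
  count-cong P≡Q (suc N) = cong₂ _+_ (count-cong P≡Q N) (cong χ (P≡Q (suc N)))

  count-shift : ∀ P t N → count (λ n → P (n + t)) N + count P t ≡ count P (N + t)
  count-shift P t zero    = refl
  count-shift P t (suc N) = begin
    count P′ N + χ (P (suc N + t)) + count P t   ≡⟨ +-swapʳ (count P′ N) _ _ ⟩
    count P′ N + count P t + χ (P (suc N + t))   ≡⟨ cong (_+ χ (P (suc N + t))) (count-shift P t N) ⟩
    count P (N + t) + χ (P (suc (N + t)))        ∎
    where
    open ≡-Reasoning
    P′ = λ n → P (n + t)
    +-swapʳ : ∀ a b c → a + b + c ≡ a + c + b
    +-swapʳ = solve 3 (λ a b c → a :+ b :+ c := a :+ c :+ b) refl
      where open Data.Nat.Solver.+-*-Solver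

  sum-map-0 : ∀ {A : Set} (l : List A) → sum (map (λ _ → 0) l) ≡ 0
  sum-map-0 []      = refl
  sum-map-0 (_ ∷ l) = sum-map-0 l

  sum-map-+ : ∀ {A : Set} (f g : A → ℕ) (l : List A) →
    sum (map (λ a → f a + g a) l) ≡ sum (map f l) + sum (map g l)
  sum-map-+ f g []      = refl
  sum-map-+ f g (a ∷ l) = trans (cong (_+_ (f a + g a)) (sum-map-+ f g l))
    (+-interchange (f a) (g a) (sum (map f l)) (sum (map g l)))
    where
    +-interchange : ∀ a b c d → a + b + (c + d) ≡ a + c + (b + d)
    +-interchange = solve 4 (λ a b c d → a :+ b :+ (c :+ d) := a :+ c :+ (b :+ d)) refl
      where open Data.Nat.Solver.+-*-Solver

  sum-map-*ˡ : ∀ {A : Set} m (f : A → ℕ) (l : List A) →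
    sum (map (λ a → m * f a) l) ≡ m * sum (map f l)
  sum-map-*ˡ m f []      = sym (ℕP.*-zeroʳ m)
  sum-map-*ˡ m f (a ∷ l) = trans (cong (_+_ (m * f a)) (sum-map-*ˡ m f l)) (sym (ℕP.*-distribˡ-+ m (f a) _))

  ≤-sum-map : ∀ {A : Set} (f : A → ℕ) {z} (l : List A) → z ∈ l → f z ≤ sum (map f l)
  ≤-sum-map f (y ∷ l) (here refl) = ℕP.m≤m+n (f y) _
  ≤-sum-map f (y ∷ l) (there z∈l) = ℕP.≤-trans (≤-sum-map f l z∈l) (ℕP.m≤n+m _ (f y))

  map-allFin-suc : ∀ {A : Set} n (h : Fin (suc n) → A) →
    map h (allFin (suc n)) ≡ h zero ∷ map (λ a → h (suc a)) (allFin n)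
  map-allFin-suc n h =
    cong (h zero ∷_) (trans (LP.map-tabulate suc h) (sym (LP.map-tabulate (λ a → a) (λ a → h (suc a)))))

  ⌊≟⌋-sym : ∀ {n} (a c : Fin n) → ⌊ a ≟ c ⌋ ≡ ⌊ c ≟ a ⌋
  ⌊≟⌋-sym a c = trans (isYes≗does (a ≟ c)) (trans (does-⇔ (mk⇔ sym sym) (a ≟ c) (c ≟ a)) (sym (isYes≗does (c ≟ a))))

  ⌊≟⌋-refl : ∀ {n} (a : Fin n) → ⌊ a ≟ a ⌋ ≡ true
  ⌊≟⌋-refl a = trans (isYes≗does (a ≟ a)) (dec-true (a ≟ a) refl)

  sum-allFin-χ≟ : ∀ n (c : Fin n) (f : Fin n → ℕ) → sum (map (λ a → χ ⌊ c ≟ a ⌋ * f a) (allFin n)) ≡ f c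
  sum-allFin-χ≟ (suc n) zero f = begin
    sum (map (λ a → χ ⌊ zero ≟ a ⌋ * f a) (allFin (suc n)))
      ≡⟨ cong sum (map-allFin-suc n (λ a → χ ⌊ zero ≟ a ⌋ * f a)) ⟩
    f zero + 0 + sum (map (λ _ → 0) (allFin n))   ≡⟨ cong (_+_ (f zero + 0)) (sum-map-0 (allFin n)) ⟩
    f zero + 0 + 0                                ≡⟨ cong (_+ 0) (ℕP.+-identityʳ (f zero)) ⟩
    f zero + 0                                    ≡⟨ ℕP.+-identityʳ (f zero) ⟩
    f zero                                        ∎
    where open ≡-Reasoning
  sum-allFin-χ≟ (suc n) (suc c) f = begin
    sum (map (λ a → χ ⌊ suc c ≟ a ⌋ * f a) (allFin (suc n)))
      ≡⟨ cong sum (map-allFin-suc n (λ a → χ ⌊ suc c ≟ a ⌋ * f a)) ⟩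
    sum (map (λ a → χ ⌊ suc c ≟ suc a ⌋ * f (suc a)) (allFin n))
      ≡⟨ cong sum (LP.map-cong (λ a → cong (λ z → χ z * f (suc a)) (suc≟suc c a)) (allFin n)) ⟩
    sum (map (λ a → χ ⌊ c ≟ a ⌋ * f (suc a)) (allFin n))
      ≡⟨ sum-allFin-χ≟ n c (λ a → f (suc a)) ⟩
    f (suc c) ∎
    where
    open ≡-Reasoning
    suc≟suc : ∀ {n} (c a : Fin n) → ⌊ suc c ≟ suc a ⌋ ≡ ⌊ c ≟ a ⌋
    suc≟suc c a with c ≟ a
    ... | yes _ = refl
    ... | no  _ = refl

  sum-allFin-χ≟-1 : ∀ n (c : Fin n) → sum (map (λ a → χ ⌊ c ≟ a ⌋) (allFin n)) ≡ 1
  sum-allFin-χ≟-1 n c = trans (cong sum (LP.map-cong (λ a → sym (ℕP.*-identityʳ (χ ⌊ c ≟ a ⌋))) (allFin n)))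
    (sum-allFin-χ≟ n c (λ _ → 1))

  count-sum : ∀ {A : Set} (as : List A) (Q : ℕ → Bool) (P : A → ℕ → Bool) →
    (∀ n → χ (Q (suc n)) ≡ sum (map (λ a → χ (P a (suc n))) as)) →
    ∀ N → count Q N ≡ sum (map (λ a → count (P a) N) as)
  count-sum as Q P χQ≡ zero    = sym (sum-map-0 as)
  count-sum as Q P χQ≡ (suc N) = trans (cong₂ _+_ (count-sum as Q P χQ≡ N) (χQ≡ N))
    (sym (sum-map-+ (λ a → count (P a) N) (λ a → χ (P a (suc N))) as))

  and-map-false : ∀ {A : Set} (f : A → Bool) {z} (l : List A) → z ∈ l → f z ≡ false → and (map f l) ≡ false
  and-map-false f (y ∷ l) (here refl) fz≡false = cong (_∧ and (map f l)) fz≡false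
  and-map-false f (y ∷ l) (there z∈l) fz≡false =
    trans (cong (f y ∧_) (and-map-false f l z∈l fz≡false)) (BP.∧-zeroʳ (f y))

  allPairs-cong : ∀ k {Q R : Fin (suc k) → Fin (suc k) → Bool} → (∀ i j → Q i j ≡ R i j) → allPairs k Q ≡ allPairs k R
  allPairs-cong k Q≡R =
    cong and (LP.map-cong (λ i → cong and (LP.map-cong (Q≡R i) (allFin (suc k)))) (allFin (suc k)))

  allPairs-guard : ∀ k (i₀ j₀ : Fin (suc k)) e (R : Fin (suc k) → Fin (suc k) → Bool) →
    allPairs k (λ i j → if ⌊ i₀ ≟ i ⌋ ∧ ⌊ j₀ ≟ j ⌋ then e ∧ R i j else R i j) ≡ e ∧ allPairs k R
  allPairs-guard k i₀ j₀ true  R = allPairs-cong k (λ i j → BP.if-eta (⌊ i₀ ≟ i ⌋ ∧ ⌊ j₀ ≟ j ⌋))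
  allPairs-guard k i₀ j₀ false R =
    and-map-false _ (allFin (suc k)) (∈-allFin i₀) (and-map-false _ (allFin (suc k)) (∈-allFin j₀) at-i₀j₀)
    where
    at-i₀j₀ : (if ⌊ i₀ ≟ i₀ ⌋ ∧ ⌊ j₀ ≟ j₀ ⌋ then false else R i₀ j₀) ≡ false
    at-i₀j₀ rewrite ⌊≟⌋-refl i₀ | ⌊≟⌋-refl j₀ = refl

  +∣i++n∣≡i++n : ∀ i n → ℤ.∣ i ∣ ≤ n → + ℤ.∣ i ℤ.+ + n ∣ ≡ i ℤ.+ + n
  +∣i++n∣≡i++n (+ _)     n _       = refl
  +∣i++n∣≡i++n -[1+ m ] n 1+m≤n rewrite ℤP.⊖-≥ 1+m≤n = refl

module _ where
  open import Data.Rational using (_<_; _≤_; ∣_∣; _-_; -_; _+_; _*_)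

  ½ : ℚ
  ½ = + 1 / 2

  *½-pos : ∀ ε → 0ℚ < ε → 0ℚ < ε * ½
  *½-pos ε ε>0 = ℚP.*-monoˡ-<-pos ½ ε>0

  *½+*½ : ∀ ε → ε * ½ + ε * ½ ≡ ε
  *½+*½ ε = trans (sym (ℚP.*-distribˡ-+ ε ½ ½)) (ℚP.*-identityʳ ε)

  ∣p+q∣<ε : ∀ {p q} ε → ∣ p ∣ < ε * ½ → ∣ q ∣ ≤ ε * ½ → ∣ p + q ∣ < ε
  ∣p+q∣<ε {p} {q} ε p< q≤ = ℚP.≤-<-trans (ℚP.∣p+q∣≤∣p∣+∣q∣ p q)
    (subst (∣ p ∣ + ∣ q ∣ <_) (*½+*½ ε) (ℚP.+-mono-<-≤ p< q≤))

  ∣p-q∣≡∣q-p∣ : ∀ p q → ∣ p - q ∣ ≡ ∣ q - p ∣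
  ∣p-q∣≡∣q-p∣ p q = trans (cong ∣_∣ (neg-sub p q)) (ℚP.∣-p∣≡∣p∣ (q - p))
    where
    neg-sub : ∀ p q → p - q ≡ - (q - p)
    neg-sub = solve 2 (λ p q → p :- q := :- (q :- p)) refl
      where open +-*-Solver

  t/suc→0 : ∀ t ε → 0ℚ < ε → ∃ λ N₀ → ∀ N → N₀ ℕ.≤ N → + t / suc N < ε
  t/suc→0 t (mkℚ (+ zero) d c) (*<* (ℤ.+<+ ()))
  t/suc→0 t (mkℚ -[1+ k ] d c) (*<* ())
  t/suc→0 t (mkℚ (+ suc k) d c) _ = t ℕ.* suc d , λ N N₀≤N →
    ℚP.toℚᵘ-cancel-< (UP.<-respˡ-≃ (UP.≃-sym (ℚP.toℚᵘ-fromℚᵘ (U.mkℚᵘ (+ t) N)))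
      (U.*<* (subst₂ ℤ._<_ (ℤP.pos-* t (suc d)) (ℤP.pos-* (suc k) (suc N))
        (ℤ.+<+ (ℕP.<-≤-trans (ℕ.s≤s N₀≤N) (ℕP.m≤n*m (suc N) (suc k)))))))

  Tends-cong : ∀ {f g L} → (∀ N → f N ≡ g N) → Tends f L → Tends g L
  Tends-cong {L = L} f≡g f→L ε ε>0 with f→L ε ε>0
  ... | N₀ , close = N₀ , λ N N₀≤N → subst (λ z → ∣ z - L ∣ < ε) (f≡g N) (close N N₀≤N)

  Tends-const : ∀ c → Tends (λ _ → c) c
  Tends-const c ε ε>0 = 0 , λ _ _ → subst (λ z → ∣ z ∣ < ε) (sym (ℚP.+-inverseʳ c)) ε>0

  Tends-+ : ∀ {f g L M} → Tends f L → Tends g M → Tends (λ N → f N + g N) (L + M)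
  Tends-+ {f} {g} {L} {M} f→L g→M ε ε>0
    with f→L (ε * ½) (*½-pos ε ε>0) | g→M (ε * ½) (*½-pos ε ε>0)
  ... | N₁ , close₁ | N₂ , close₂ = N₁ ⊔ N₂ , λ N le →
    subst (λ z → ∣ z ∣ < ε) (sym (sub-+ (f N) (g N) L M))
      (∣p+q∣<ε ε (close₁ N (ℕP.≤-trans (ℕP.m≤m⊔n N₁ N₂) le))
                 (ℚP.<⇒≤ (close₂ N (ℕP.≤-trans (ℕP.m≤n⊔m N₁ N₂) le))))
    where
    sub-+ : ∀ a b l m → (a + b) - (l + m) ≡ (a - l) + (b - m)
    sub-+ = solve 4 (λ a b l m → (a :+ b) :- (l :+ m) := (a :- l) :+ (b :- m)) refl
      where open +-*-Solver

  sumℚ : List ℚ → ℚ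
  sumℚ = foldr _+_ 0ℚ

  Tends-sum : ∀ {A : Set} (as : List A) {f : A → ℕ → ℚ} {L : A → ℚ} →
    (∀ a → Tends (f a) (L a)) → Tends (λ N → sumℚ (map (λ a → f a N) as)) (sumℚ (map L as))
  Tends-sum []       _   = Tends-const 0ℚ
  Tends-sum (a ∷ as) {f} {L} f→L = Tends-+ {f a} {λ N → sumℚ (map (λ a → f a N) as)} (f→L a) (Tends-sum as f→L)

  Tends-shift⇔ : ∀ f {L} t → Tends f L ⇔ Tends (λ N → f (N ℕ.+ t)) L
  Tends-shift⇔ f {L} t = mk⇔ drop undrop
    where
    drop : Tends f L → Tends (λ N → f (N ℕ.+ t)) L
    drop f→L ε ε>0 with f→L ε ε>0
    ... | N₀ , close = N₀ , λ N le → close (N ℕ.+ t) (ℕP.≤-trans le (ℕP.m≤m+n N t))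
    undrop : Tends (λ N → f (N ℕ.+ t)) L → Tends f L
    undrop f→L ε ε>0 with f→L ε ε>0
    ... | N₀ , close = N₀ ℕ.+ t , λ N le →
      let t≤N = ℕP.≤-trans (ℕP.m≤n+m t N₀) le
      in subst (λ z → ∣ f z - L ∣ < ε) (ℕP.m∸n+n≡m t≤N)
           (close (N ℕ.∸ t) (subst (ℕ._≤ N ℕ.∸ t) (ℕP.m+n∸n≡m N₀ t) (ℕP.∸-monoˡ-≤ t le)))

  Tends-perturb : ∀ {f g L} t → Tends f L → (∀ N → ∣ f N - g N ∣ ≤ + t / suc N) → Tends g L
  Tends-perturb {f} {g} {L} t f→L f≈g ε ε>0
    with f→L (ε * ½) (*½-pos ε ε>0) | t/suc→0 t (ε * ½) (*½-pos ε ε>0)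
  ... | N₁ , close₁ | N₂ , small = N₁ ⊔ N₂ , λ N le →
    subst (λ z → ∣ z ∣ < ε) (sym (sub-via (g N) (f N) L))
      (∣p+q∣<ε ε (close₁ N (ℕP.≤-trans (ℕP.m≤m⊔n N₁ N₂) le))
        (ℚP.<⇒≤ (ℚP.≤-<-trans (subst (_≤ _) (∣p-q∣≡∣q-p∣ (f N) (g N)) (f≈g N))
                              (small N (ℕP.≤-trans (ℕP.m≤n⊔m N₁ N₂) le)))))
    where
    sub-via : ∀ g f l → g - l ≡ (f - l) + (g - f)
    sub-via = solve 3 (λ g f l → g :- l := (f :- l) :+ (g :- f)) refl
      where open +-*-Solver

  /suc-cong : ∀ a b d e → a ℕ.* suc e ≡ b ℕ.* suc d → + a / suc d ≡ + b / suc e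
  /suc-cong a b d e eq = ℚP.fromℚᵘ-cong {U.mkℚᵘ (+ a) d} {U.mkℚᵘ (+ b) e}
    (U.*≡* (trans (sym (ℤP.pos-* a (suc e))) (trans (cong +_ eq) (ℤP.pos-* b (suc d)))))

  /suc-+ : ∀ a b d → + a / suc d + + b / suc d ≡ + (a ℕ.+ b) / suc d
  /suc-+ a b d = ℚP.toℚᵘ-injective (UP.≃-trans (ℚP.toℚᵘ-homo-+ (+ a / suc d) (+ b / suc d))
    (UP.≃-trans (UP.+-cong (ℚP.toℚᵘ-fromℚᵘ (U.mkℚᵘ (+ a) d)) (ℚP.toℚᵘ-fromℚᵘ (U.mkℚᵘ (+ b) d)))
    (UP.≃-trans (U.*≡* cross) (UP.≃-sym (ℚP.toℚᵘ-fromℚᵘ (U.mkℚᵘ (+ (a ℕ.+ b)) d))))))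
    where
    cross : (+ a ℤ.* + suc d ℤ.+ + b ℤ.* + suc d) ℤ.* + suc d ≡ + (a ℕ.+ b) ℤ.* + (suc d ℕ.* suc d)
    cross rewrite ℤP.pos-+ a b | ℤP.pos-* (suc d) (suc d) =
      solve 3 (λ A B D → (A :* D :+ B :* D) :* D := (A :+ B) :* (D :* D)) refl (+ a) (+ b) (+ suc d)
      where open ℤS

  -- Cross-multiplied, the difference is s(N+1) − c·t, and both terms are at most t(N+1+t).
  ∣/suc-/suc∣≤ : ∀ N t c s → s ℕ.≤ t → c ℕ.+ s ℕ.≤ suc N ℕ.+ t →
    ∣ + (c ℕ.+ s) / suc (N ℕ.+ t) - + c / suc N ∣ ≤ + t / suc N
  ∣/suc-/suc∣≤ N t c s s≤t c+s≤ = ℚP.toℚᵘ-cancel-≤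
    (UP.≤-respʳ-≃ (UP.≃-sym (ℚP.toℚᵘ-fromℚᵘ (U.mkℚᵘ (+ t) N)))
    (UP.≤-respˡ-≃ (UP.≃-sym toℚᵘ-diff) (U.*≤* (subst₂ ℤ._≤_ (ℤP.pos-* ℤ.∣ X ∣ (suc N))
       (trans (cong +_ (ℕP.*-assoc t (suc (N ℕ.+ t)) (suc N))) (ℤP.pos-* t _))
       (ℤ.+≤+ (ℕP.*-monoˡ-≤ (suc N) ∣X∣≤))))))
    where
    p = + (c ℕ.+ s) / suc (N ℕ.+ t)
    q = + c / suc N
    X = + (c ℕ.+ s) ℤ.* + suc N ℤ.+ ℤ.- + c ℤ.* + suc (N ℕ.+ t)
    toℚᵘ-diff : toℚᵘ ∣ p - q ∣ U.≃ U.∣ U.mkℚᵘ (+ (c ℕ.+ s)) (N ℕ.+ t) U.+ U.- U.mkℚᵘ (+ c) N ∣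
    toℚᵘ-diff = UP.≃-trans (ℚP.toℚᵘ-homo-∣-∣ (p - q)) (UP.∣-∣-cong
      (UP.≃-trans (ℚP.toℚᵘ-homo-+ p (- q))
        (UP.+-cong (ℚP.toℚᵘ-fromℚᵘ (U.mkℚᵘ (+ (c ℕ.+ s)) (N ℕ.+ t)))
          (UP.≃-trans (ℚP.toℚᵘ-homo‿- q) (UP.-‿cong (ℚP.toℚᵘ-fromℚᵘ (U.mkℚᵘ (+ c) N)))))))
    X≡ : X ≡ (s ℕ.* suc (N ℕ.+ t)) ℤ.⊖ ((c ℕ.+ s) ℕ.* t)
    X≡ = trans expand (ℤP.m-n≡m⊖n (s ℕ.* suc (N ℕ.+ t)) ((c ℕ.+ s) ℕ.* t))
      where
      expand : X ≡ + (s ℕ.* suc (N ℕ.+ t)) ℤ.+ ℤ.- + ((c ℕ.+ s) ℕ.* t)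
      expand rewrite ℤP.pos-* s (suc (N ℕ.+ t)) | ℤP.pos-* (c ℕ.+ s) t | ℤP.pos-+ c s | ℤP.pos-+ (suc N) t =
        solve 4 (λ C S D T → (C :+ S) :* D :+ :- C :* (D :+ T) := S :* (D :+ T) :+ :- ((C :+ S) :* T))
          refl (+ c) (+ s) (+ suc N) (+ t)
        where open ℤS
    ∣X∣≤ : ℤ.∣ X ∣ ℕ.≤ t ℕ.* suc (N ℕ.+ t)
    ∣X∣≤ = subst (ℕ._≤ _) (sym (cong ℤ.∣_∣ X≡))
      (ℕP.≤-trans (ℤP.∣m⊝n∣≤m⊔n (s ℕ.* suc (N ℕ.+ t)) ((c ℕ.+ s) ℕ.* t))
        (ℕP.⊔-lub (ℕP.*-monoˡ-≤ (suc (N ℕ.+ t)) s≤t)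
                  (subst ((c ℕ.+ s) ℕ.* t ℕ.≤_) (ℕP.*-comm (suc (N ℕ.+ t)) t) (ℕP.*-monoˡ-≤ t c+s≤))))

  freq≡ : ∀ P N → freq P N ≡ + count P (suc N) / suc N
  freq≡ P N = cong (λ c → + c / suc N) (countUpTo≡count P (suc N))

  freq-cong : ∀ {P Q} → (∀ n → P n ≡ Q n) → ∀ N → freq P N ≡ freq Q N
  freq-cong {P} {Q} P≡Q N =
    trans (freq≡ P N) (trans (cong (λ c → + c / suc N) (count-cong P≡Q (suc N))) (sym (freq≡ Q N)))

  -- Among 1,…,N+t the first t values contribute at most t to the count.
  freq-shift-close : ∀ P t N → ∣ freq P (N ℕ.+ t) - freq (λ n → P (n ℕ.+ t)) N ∣ ≤ + t / suc N
  freq-shift-close P t N = subst₂ (λ u v → ∣ u - v ∣ ≤ + t / suc N)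
    (trans (cong (λ c → + c / suc (N ℕ.+ t)) split) (sym (freq≡ P (N ℕ.+ t))))
    (sym (freq≡ P′ N))
    (∣/suc-/suc∣≤ N t (count P′ (suc N)) (count P t) (count≤ P t)
      (subst (ℕ._≤ suc N ℕ.+ t) (sym split) (count≤ P (suc N ℕ.+ t))))
    where
    P′ = λ n → P (n ℕ.+ t)
    split = count-shift P t (suc N)

  freq-shift⇔ : ∀ P t {L} → Tends (freq P) L ⇔ Tends (freq (λ n → P (n ℕ.+ t))) L
  freq-shift⇔ P t = mk⇔
    (λ P→L → Tends-perturb {f} t (Equivalence.to (Tends-shift⇔ (freq P) t) P→L) (freq-shift-close P t))
    (λ P′→L → Equivalence.from (Tends-shift⇔ (freq P) t) (Tends-perturb {freq P′} {f} t P′→L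
      (λ N → subst (_≤ _) (∣p-q∣≡∣q-p∣ (f N) (freq P′ N)) (freq-shift-close P t N))))
    where
    P′ = λ n → P (n ℕ.+ t)
    f = λ N → freq P (N ℕ.+ t)

  /suc-sum : ∀ {A : Set} (as : List A) (c : A → ℕ) N →
    + sum (map c as) / suc N ≡ sumℚ (map (λ a → + c a / suc N) as)
  /suc-sum []       c N = ℚP.0/n≡0 (suc N)
  /suc-sum (a ∷ as) c N = trans (sym (/suc-+ (c a) (sum (map c as)) N))
    (cong (_+_ (+ c a / suc N)) (/suc-sum as c N))

  freq-sum : ∀ {A : Set} (as : List A) (Q : ℕ → Bool) (P : A → ℕ → Bool) →
    (∀ n → χ (Q (suc n)) ≡ sum (map (λ a → χ (P a (suc n))) as)) →
    ∀ N → freq Q N ≡ sumℚ (map (λ a → freq (P a) N) as)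
  freq-sum as Q P χQ≡ N = begin
    freq Q N                                               ≡⟨ freq≡ Q N ⟩
    + count Q (suc N) / suc N                              ≡⟨ cong (λ c → + c / suc N) (count-sum as Q P χQ≡ (suc N)) ⟩
    + sum (map (λ a → count (P a) (suc N)) as) / suc N     ≡⟨ /suc-sum as (λ a → count (P a) (suc N)) N ⟩
    sumℚ (map (λ a → + count (P a) (suc N) / suc N) as)    ≡⟨ cong sumℚ (LP.map-cong (λ a → sym (freq≡ (P a) N)) as) ⟩
    sumℚ (map (λ a → freq (P a) N) as)                     ∎
    where open ≡-Reasoning

  invPow-suc : ∀ c L → ∃ λ D → suc c ℕ.^ L ≡ suc D × invPow (suc c) L ≡ + 1 / suc D
  invPow-suc c L = as-suc (suc c ℕ.^ L) {{ℕP.m^n≢0 (suc c) L}}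
    where
    as-suc : ∀ n .{{_ : ℕ.NonZero n}} → ∃ λ D → n ≡ suc D × + 1 / n ≡ + 1 / suc D
    as-suc (suc D) = D , refl , refl

  sumℚ-map-1/suc : ∀ {A : Set} (as : List A) d → sumℚ (map (λ _ → + 1 / suc d) as) ≡ + length as / suc d
  sumℚ-map-1/suc []       d = sym (ℚP.0/n≡0 (suc d))
  sumℚ-map-1/suc (_ ∷ as) d = trans (cong (_+_ (+ 1 / suc d)) (sumℚ-map-1/suc as d)) (/suc-+ 1 (length as) d)

  sumℚ-invPow-suc : ∀ c L → sumℚ (map (λ _ → invPow (suc c) (suc L)) (allFin (suc c))) ≡ invPow (suc c) L
  sumℚ-invPow-suc c L with invPow-suc c L | invPow-suc c (suc L)
  ... | D , bᴸ≡ , invPowᴸ≡ | E , bᴸ⁺¹≡ , invPowᴸ⁺¹≡ = begin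
    sumℚ (map (λ _ → invPow (suc c) (suc L)) (allFin (suc c)))
      ≡⟨ cong sumℚ (LP.map-cong (λ _ → invPowᴸ⁺¹≡) (allFin (suc c))) ⟩
    sumℚ (map (λ _ → + 1 / suc E) (allFin (suc c)))  ≡⟨ sumℚ-map-1/suc (allFin (suc c)) E ⟩
    + length (allFin (suc c)) / suc E                ≡⟨ cong (λ n → + n / suc E) (LP.length-tabulate {n = suc c} (λ a → a)) ⟩
    + suc c / suc E                                  ≡⟨ /suc-cong (suc c) 1 E D b·bᴸ≡ ⟩
    + 1 / suc D                                      ≡⟨ sym invPowᴸ≡ ⟩
    invPow (suc c) L                                 ∎
    where
    open ≡-Reasoning
    b·bᴸ≡ : suc c ℕ.* suc D ≡ 1 ℕ.* suc E
    b·bᴸ≡ = trans (cong (suc c ℕ.*_) (sym bᴸ≡)) (trans bᴸ⁺¹≡ (sym (ℕP.*-identityˡ (suc E))))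

module ShiftedNormality (c p₁ p₂ : ℕ) (1<p₁ : 1 ℕ.< p₁) (1<p₂ : 1 ℕ.< p₂) (x : ℕ → Fin (suc c)) (k : ℕ) where
  open import Data.Nat using (_+_; _*_; _∸_; _^_; _≤_; z≤n; s≤s)

  Word : Set
  Word = List (Fin (suc c))

  Table : Set → Set
  Table A = Fin (suc k) → Fin (suc k) → A

  indices : List (Fin (suc k))
  indices = allFin (suc k)

  ΣΣ : Table ℕ → ℕ
  ΣΣ f = sum (map (λ i → sum (map (λ j → f i j) indices)) indices)

  ΣΣ-cong : ∀ {f g : Table ℕ} → (∀ i j → f i j ≡ g i j) → ΣΣ f ≡ ΣΣ g
  ΣΣ-cong f≡g = cong sum (LP.map-cong (λ i → cong sum (LP.map-cong (f≡g i) indices)) indices)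

  ΣΣ-+ : ∀ (f g : Table ℕ) → ΣΣ (λ i j → f i j + g i j) ≡ ΣΣ f + ΣΣ g
  ΣΣ-+ f g = trans (cong sum (LP.map-cong (λ i → sum-map-+ (f i) (g i) indices) indices))
    (sum-map-+ (λ i → sum (map (f i) indices)) (λ i → sum (map (g i) indices)) indices)

  at : Fin (suc k) → Fin (suc k) → Table Bool
  at i₀ j₀ i j = ⌊ i₀ ≟ i ⌋ ∧ ⌊ j₀ ≟ j ⌋

  ΣΣ-sift : ∀ i₀ j₀ (f : Table ℕ) → ΣΣ (λ i j → χ (at i₀ j₀ i j) * f i j) ≡ f i₀ j₀
  ΣΣ-sift i₀ j₀ f = trans (cong sum (LP.map-cong row indices)) (sum-allFin-χ≟ (suc k) i₀ (λ i → f i j₀))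
    where
    row : ∀ i → sum (map (λ j → χ (at i₀ j₀ i j) * f i j) indices) ≡ χ ⌊ i₀ ≟ i ⌋ * f i j₀
    row i = begin
      sum (map (λ j → χ (at i₀ j₀ i j) * f i j) indices)
        ≡⟨ cong sum (LP.map-cong (λ j → trans (cong (_* f i j) (χ-∧ ⌊ i₀ ≟ i ⌋ ⌊ j₀ ≟ j ⌋))
                                             (ℕP.*-assoc (χ ⌊ i₀ ≟ i ⌋) _ _)) indices) ⟩
      sum (map (λ j → χ ⌊ i₀ ≟ i ⌋ * (χ ⌊ j₀ ≟ j ⌋ * f i j)) indices)
        ≡⟨ sum-map-*ˡ (χ ⌊ i₀ ≟ i ⌋) (λ j → χ ⌊ j₀ ≟ j ⌋ * f i j) indices ⟩
      χ ⌊ i₀ ≟ i ⌋ * sum (map (λ j → χ ⌊ j₀ ≟ j ⌋ * f i j) indices)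
        ≡⟨ cong (χ ⌊ i₀ ≟ i ⌋ *_) (sum-allFin-χ≟ (suc k) j₀ (f i)) ⟩
      χ ⌊ i₀ ≟ i ⌋ * f i j₀ ∎
      where open ≡-Reasoning

  ΣΣ-sift′ : ∀ (f : Table ℕ) i j → ΣΣ (λ i′ j′ → f i′ j′ * χ (at i′ j′ i j)) ≡ f i j
  ΣΣ-sift′ f i j = trans (ΣΣ-cong swap) (ΣΣ-sift i j f)
    where
    swap : ∀ i′ j′ → f i′ j′ * χ (at i′ j′ i j) ≡ χ (at i j i′ j′) * f i′ j′
    swap i′ j′ = trans (ℕP.*-comm (f i′ j′) _)
      (cong (λ b → χ b * f i′ j′) (cong₂ _∧_ (⌊≟⌋-sym i′ i) (⌊≟⌋-sym j′ j)))

  prependAt : Fin (suc k) → Fin (suc k) → Fin (suc c) → Table Word → Table Word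
  prependAt i₀ j₀ a v i j = if at i₀ j₀ i j then a ∷ v i j else v i j

  totalLength-prependAt : ∀ i₀ j₀ a v → totalLength (prependAt i₀ j₀ a v) ≡ suc (totalLength v)
  totalLength-prependAt i₀ j₀ a v = begin
    ΣΣ (λ i j → length (prependAt i₀ j₀ a v i j))        ≡⟨ ΣΣ-cong length-prependAt ⟩
    ΣΣ (λ i j → length (v i j) + χ (at i₀ j₀ i j) * 1)   ≡⟨ ΣΣ-+ (λ i j → length (v i j)) _ ⟩
    totalLength v + ΣΣ (λ i j → χ (at i₀ j₀ i j) * 1)    ≡⟨ cong (_+_ (totalLength v)) (ΣΣ-sift i₀ j₀ (λ _ _ → 1)) ⟩
    totalLength v + 1                                    ≡⟨ ℕP.+-comm (totalLength v) 1 ⟩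
    suc (totalLength v)                                  ∎
    where
    open ≡-Reasoning
    length-prependAt : ∀ i j → length (prependAt i₀ j₀ a v i j) ≡ length (v i j) + χ (at i₀ j₀ i j) * 1
    length-prependAt i j with at i₀ j₀ i j
    ... | true  = ℕP.+-comm 1 (length (v i j))
    ... | false = sym (ℕP.+-identityʳ (length (v i j)))

  occursAt-∷ : ∀ a (u : Word) q → 1 ≤ q → occursAt x (a ∷ u) (+ q) ≡ ⌊ x (q ∸ 1) ≟ a ⌋ ∧ occursAt x u (+ (q + 1))
  occursAt-∷ a u (suc q) _ = cong (λ r → ⌊ x q ≟ a ⌋ ∧ occursAt x u (+ r)) (ℕP.+-comm 1 (suc q))

  -- The positions must be ≥ 1: a word never occurs at position 0.
  allPairs-occursAt-prependAt : ∀ i₀ j₀ a v (q : Table ℕ) → 1 ≤ q i₀ j₀ →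
    allPairs k (λ i j → occursAt x (prependAt i₀ j₀ a v i j) (+ q i j)) ≡
    ⌊ x (q i₀ j₀ ∸ 1) ≟ a ⌋ ∧ allPairs k (λ i j → occursAt x (v i j) (+ (q i j + χ (at i₀ j₀ i j))))
  allPairs-occursAt-prependAt i₀ j₀ a v q 1≤q₀ = trans (allPairs-cong k entry)
    (allPairs-guard k i₀ j₀ ⌊ x (q i₀ j₀ ∸ 1) ≟ a ⌋ (λ i j → occursAt x (v i j) (+ (q i j + χ (at i₀ j₀ i j)))))
    where
    entry : ∀ i j → occursAt x (prependAt i₀ j₀ a v i j) (+ q i j) ≡
      (if at i₀ j₀ i j then ⌊ x (q i₀ j₀ ∸ 1) ≟ a ⌋ ∧ occursAt x (v i j) (+ (q i j + χ (at i₀ j₀ i j)))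
                       else occursAt x (v i j) (+ (q i j + χ (at i₀ j₀ i j))))
    entry i j with i₀ ≟ i | j₀ ≟ j
    ... | yes refl | yes refl = occursAt-∷ a (v i₀ j₀) (q i₀ j₀) 1≤q₀
    ... | yes refl | no _     = cong (λ r → occursAt x (v i j) (+ r)) (sym (ℕP.+-identityʳ (q i j)))
    ... | no _     | _        = cong (λ r → occursAt x (v i j) (+ r)) (sym (ℕP.+-identityʳ (q i j)))

  coeff : Table ℕ
  coeff i j = (p₁ ∸ 1) * (p₂ ∸ 1) * p₁ ^ toℕ i * p₂ ^ toℕ j

  1≤coeff : ∀ i j → 1 ≤ coeff i j
  1≤coeff i j = ℕP.*-mono-≤ (ℕP.*-mono-≤ (ℕP.*-mono-≤ (ℕP.∸-monoˡ-≤ 1 1<p₁) (ℕP.∸-monoˡ-≤ 1 1<p₂))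
    (ℕP.m^n>0 p₁ {{ℕ.>-nonZero (ℕP.<⇒≤ 1<p₁)}} (toℕ i)))
    (ℕP.m^n>0 p₂ {{ℕ.>-nonZero (ℕP.<⇒≤ 1<p₂)}} (toℕ j))

  SN : Table ℤ → Set
  SN = ShiftedNormal (suc c) p₁ p₂ x k

  hits : Table Word → Table ℤ → ℕ → Bool
  hits u δ n = allPairs k (λ i j → occursAt x (u i j) (pos p₁ p₂ (toℕ i) (toℕ j) n (δ i j)))

  SN-cong : ∀ {δ δ′} → (∀ i j → δ i j ≡ δ′ i j) → SN δ → SN δ′
  SN-cong δ≡δ′ SNδ u = Tends-cong (freq-cong (λ n → allPairs-cong k (λ i j →
    cong (λ d → occursAt x (u i j) (pos p₁ p₂ (toℕ i) (toℕ j) n d)) (δ≡δ′ i j)))) (SNδ u)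

  shift : Table ℤ → ℕ → Table ℤ
  shift δ t i j = δ i j ℤ.+ + (coeff i j * t)

  pos-shift : ∀ i j n t d →
    pos p₁ p₂ (toℕ i) (toℕ j) n (d ℤ.+ + (coeff i j * t)) ≡ pos p₁ p₂ (toℕ i) (toℕ j) (n + t) d
  pos-shift i j n t d rewrite ℕP.*-distribˡ-+ (coeff i j) n t | ℤP.pos-+ (coeff i j * n) (coeff i j * t) =
    solve 3 (λ A B D → A :+ (D :+ B) := A :+ B :+ D) refl (+ (coeff i j * n)) (+ (coeff i j * t)) d
    where open ℤS

  hits-shift : ∀ u δ t n → hits u (shift δ t) n ≡ hits u δ (n + t)
  hits-shift u δ t n = allPairs-cong k (λ i j → cong (occursAt x (u i j)) (pos-shift i j n t (δ i j)))

  SN-shift⇔ : ∀ δ t → SN δ ⇔ SN (shift δ t)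
  SN-shift⇔ δ t = mk⇔
    (λ SNδ u → Tends-cong (freq-cong (λ n → sym (hits-shift u δ t n)))
                          (Equivalence.to (freq-shift⇔ (hits u δ) t) (SNδ u)))
    (λ SNδ+ u → Equivalence.from (freq-shift⇔ (hits u δ) t)
                                 (Tends-cong (freq-cong (hits-shift u δ t)) (SNδ+ u)))

  SN⁺ : Table ℕ → Set
  SN⁺ d = SN (λ i j → + d i j)

  hits-prependAt : ∀ i₀ j₀ a v (d : Table ℕ) n →
    hits (prependAt i₀ j₀ a v) (λ i j → + d i j) (suc n) ≡
    ⌊ x (coeff i₀ j₀ * suc n + d i₀ j₀ ∸ 1) ≟ a ⌋ ∧ hits v (λ i j → + (d i j + χ (at i₀ j₀ i j))) (suc n)
  hits-prependAt i₀ j₀ a v d n =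
    trans (allPairs-occursAt-prependAt i₀ j₀ a v (λ i j → coeff i j * suc n + d i j) 1≤q₀)
      (cong (⌊ x (coeff i₀ j₀ * suc n + d i₀ j₀ ∸ 1) ≟ a ⌋ ∧_)
        (allPairs-cong k (λ i j → cong (λ r → occursAt x (v i j) (+ r))
          (ℕP.+-assoc (coeff i j * suc n) (d i j) (χ (at i₀ j₀ i j))))))
    where
    1≤q₀ : 1 ≤ coeff i₀ j₀ * suc n + d i₀ j₀
    1≤q₀ = ℕP.≤-trans (ℕP.*-mono-≤ (1≤coeff i₀ j₀) (s≤s (z≤n {n}))) (ℕP.m≤m+n _ (d i₀ j₀))

  χ-hits-prependAt : ∀ i₀ j₀ v (d : Table ℕ) n →
    χ (hits v (λ i j → + (d i j + χ (at i₀ j₀ i j))) (suc n)) ≡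
    sum (map (λ a → χ (hits (prependAt i₀ j₀ a v) (λ i j → + d i j) (suc n))) (allFin (suc c)))
  χ-hits-prependAt i₀ j₀ v d n = begin
    χ H                                                      ≡⟨ sym (ℕP.*-identityʳ (χ H)) ⟩
    χ H * 1                                                  ≡⟨ cong (χ H *_) (sym (sum-allFin-χ≟-1 (suc c) y)) ⟩
    χ H * sum (map (λ a → χ ⌊ y ≟ a ⌋) (allFin (suc c)))     ≡⟨ sym (sum-map-*ˡ (χ H) _ (allFin (suc c))) ⟩
    sum (map (λ a → χ H * χ ⌊ y ≟ a ⌋) (allFin (suc c)))     ≡⟨ cong sum (LP.map-cong split (allFin (suc c))) ⟩
    sum (map (λ a → χ (hits (prependAt i₀ j₀ a v) (λ i j → + d i j) (suc n))) (allFin (suc c))) ∎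
    where
    open ≡-Reasoning
    H = hits v (λ i j → + (d i j + χ (at i₀ j₀ i j))) (suc n)
    y = x (coeff i₀ j₀ * suc n + d i₀ j₀ ∸ 1)
    split : ∀ a → χ H * χ ⌊ y ≟ a ⌋ ≡ χ (hits (prependAt i₀ j₀ a v) (λ i j → + d i j) (suc n))
    split a = trans (ℕP.*-comm (χ H) _) (trans (sym (χ-∧ ⌊ y ≟ a ⌋ H)) (cong χ (sym (hits-prependAt i₀ j₀ a v d n))))

  Increment : Table ℕ → Set
  Increment e = ∀ d → SN⁺ d → SN⁺ (λ i j → d i j + e i j)

  increment-at : ∀ i₀ j₀ → Increment (λ i j → χ (at i₀ j₀ i j))
  increment-at i₀ j₀ d SN⁺d v =
    Tends-cong (λ N → sym (freq-sum letters (hits v (λ i j → + (d i j + χ (at i₀ j₀ i j)))) P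
                                    (χ-hits-prependAt i₀ j₀ v d) N))
      (subst (Tends (λ N → sumℚ (map (λ a → freq (P a) N) letters))) limit
        (Tends-sum letters {λ a → freq (P a)} (λ a → SN⁺d (prependAt i₀ j₀ a v))))
    where
    letters = allFin (suc c)
    P : Fin (suc c) → ℕ → Bool
    P a = hits (prependAt i₀ j₀ a v) (λ i j → + d i j)
    limit : sumℚ (map (λ a → invPow (suc c) (totalLength (prependAt i₀ j₀ a v))) letters) ≡ invPow (suc c) (totalLength v)
    limit = trans (cong sumℚ (LP.map-cong (λ a → cong (invPow (suc c)) (totalLength-prependAt i₀ j₀ a v)) letters))
      (sumℚ-invPow-suc c (totalLength v))

  Increment-cong : ∀ {e e′} → (∀ i j → e i j ≡ e′ i j) → Increment e → Increment e′
  Increment-cong e≡e′ inc d SN⁺d = SN-cong (λ i j → cong (λ z → + (d i j + z)) (e≡e′ i j)) (inc d SN⁺d)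

  Increment-0 : Increment (λ _ _ → 0)
  Increment-0 d = SN-cong (λ i j → cong +_ (sym (ℕP.+-identityʳ (d i j))))

  Increment-+ : ∀ {e e′} → Increment e → Increment e′ → Increment (λ i j → e i j + e′ i j)
  Increment-+ {e} {e′} inc inc′ d SN⁺d =
    SN-cong (λ i j → cong +_ (ℕP.+-assoc (d i j) (e i j) (e′ i j))) (inc′ _ (inc d SN⁺d))

  Increment-* : ∀ {e} m → Increment e → Increment (λ i j → m * e i j)
  Increment-* zero    inc = Increment-0
  Increment-* (suc m) inc = Increment-+ inc (Increment-* m inc)

  Increment-sum : ∀ {X : Set} (ys : List X) (g : X → Table ℕ) →
    (∀ y → Increment (g y)) → Increment (λ i j → sum (map (λ y → g y i j) ys))
  Increment-sum []       g inc = Increment-0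
  Increment-sum (y ∷ ys) g inc = Increment-+ (inc y) (Increment-sum ys g inc)

  increment : ∀ e → Increment e
  increment e = Increment-cong (ΣΣ-sift′ e)
    (Increment-sum indices _ λ i′ → Increment-sum indices _ λ j′ → Increment-* (e i′ j′) (increment-at i′ j′))

  SN⁺-mono : ∀ {d d′} → (∀ i j → d i j ≤ d′ i j) → SN⁺ d → SN⁺ d′
  SN⁺-mono {d} {d′} d≤d′ SN⁺d =
    SN-cong (λ i j → cong +_ (ℕP.m+[n∸m]≡n (d≤d′ i j))) (increment (λ i j → d′ i j ∸ d i j) d SN⁺d)

  SN-0⇔ : ∀ δ → SN (λ _ _ → + 0) ⇔ SN δ
  SN-0⇔ δ = mk⇔
    (λ SN0 → Equivalence.from (SN-shift⇔ δ T) (SN-cong +D≡ (SN⁺-mono (λ _ _ → z≤n) SN0)))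
    (λ SNδ → Equivalence.from (SN-shift⇔ (λ _ _ → + 0) (T + T))
               (SN⁺-mono D≤ (SN-cong (λ i j → sym (+D≡ i j)) (Equivalence.to (SN-shift⇔ δ T) SNδ))))
    where
    T = ΣΣ (λ i j → ℤ.∣ δ i j ∣)
    ∣δ∣≤coeff*T : ∀ i j → ℤ.∣ δ i j ∣ ≤ coeff i j * T
    ∣δ∣≤coeff*T i j = ℕP.≤-trans
      (ℕP.≤-trans (≤-sum-map (λ j → ℤ.∣ δ i j ∣) indices (∈-allFin j))
                  (≤-sum-map (λ i → sum (map (λ j → ℤ.∣ δ i j ∣) indices)) indices (∈-allFin i)))
      (ℕP.m≤n*m T (coeff i j) {{ℕ.>-nonZero (1≤coeff i j)}})
    D : Table ℕ
    D i j = ℤ.∣ shift δ T i j ∣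
    +D≡ : ∀ i j → + D i j ≡ shift δ T i j
    +D≡ i j = +∣i++n∣≡i++n (δ i j) (coeff i j * T) (∣δ∣≤coeff*T i j)
    D≤ : ∀ i j → D i j ≤ coeff i j * (T + T)
    D≤ i j = ℕP.≤-trans (ℤP.∣i+j∣≤∣i∣+∣j∣ (δ i j) (+ (coeff i j * T)))
      (subst (ℤ.∣ δ i j ∣ + coeff i j * T ≤_) (sym (ℕP.*-distribˡ-+ (coeff i j) T T))
        (ℕP.+-monoˡ-≤ (coeff i j * T) (∣δ∣≤coeff*T i j)))

lemma7 : (b : ℕ) → 2 ℕ.≤ b → (p₁ p₂ : ℕ) → Prime p₁ → Prime p₂ →
    (x : ℕ → Fin b) → (k : ℕ) → (δ : Fin (suc k) → Fin (suc k) → ℤ) →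
    ShiftedNormal b p₁ p₂ x k (λ _ _ → + 0) ⇔ ShiftedNormal b p₁ p₂ x k δ
lemma7 zero    ()
lemma7 (suc c) _ p₁ p₂ prime₁ prime₂ x k =
  ShiftedNormality.SN-0⇔ c p₁ p₂ (1<prime prime₁) (1<prime prime₂) x k
  where
  1<prime : ∀ {p} → Prime p → 1 ℕ.< p
  1<prime {p} p-prime = ℕ.nonTrivial⇒n>1 p {{prime⇒nonTrivial p-prime}}
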